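{- For every $k \geq 1$, the equivalence relation $\equiv_k$ on packed words, defined by $u \equiv_k v$ if and only if $\mathrm{F}_k(u) = \mathrm{F}_k(v)$, is a nonsymmetric operad congruence of $\mathsf{PAs}^{\leftarrow}$: for all $n,m\geq 1$, $u,u' \in \mathfrak{P}[n]$ with $u \equiv_k u'$, $v,v' \in \mathfrak{P}[m]$ with $v \equiv_k v'$, and $i \in [n]$, one has $u\circ_i v \equiv_k u' \circ_i v'$.
   Context: A packed word is a word over $\{1,2,\dots\}$ whose set of letters is $[n]=\{1,\dots,n\}$ for some $n$; $\mathfrak{P}[n]$ is the set of packed words with set of letters exactly $[n]$. $\mathrm{inc}_{\alpha,\beta}(u)$ adds $\alpha$ to each letter of $u$ strictly greater than $\beta$. The set-operad $\mathsf{PAs}^{\leftarrow}$ has arity-$n$ elements the words of $\mathfrak{P}[n]$, and for $u\in\mathfrak{P}[n]$, $i\in[n]$, $v\in\mathfrak{P}[m]$, $u\circ_i v$ is obtained from $\mathrm{inc}_{m-1,i}(u)$ by replacing every occurrence of $i$ by $\mathrm{inc}_{i-1,0}(v)$. For $k\geq 1$, $\mathrm{F}_k(u)$ is the packed word obtained from $u$ by deleting every occurrence of a letter $a$ that has at least $k$ occurrences of $a$ to its left (i.e. keeping only the first $k$ occurrences of each letter); e.g. $\mathrm{F}_2(421431412)=4214312$. -}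

module Defs where

open import Data.Nat using (ℕ; zero; suc; _+_; _∸_; _≤_; _<_; _<ᵇ_; _≡ᵇ_)
open import Data.Bool using (Bool; true; false; if_then_else_)
open import Data.List using (List; []; _∷_; map; concatMap; [_])
open import Data.List.Membership.Propositional using (_∈_)
open import Data.Product using (_×_)
open import Relation.Binary.PropositionalEquality using (_≡_)

Word : Set
Word = List ℕ

IsPacked : ℕ → Word → Set
IsPacked n u = (∀ a → a ∈ u → (1 ≤ a × a ≤ n)) × (∀ a → 1 ≤ a → a ≤ n → a ∈ u)

inc : ℕ → ℕ → Word → Word
inc α β u = map (λ a → if β <ᵇ a then a + α else a) u

-- u ∘_i v for v ∈ P[m]: from inc_{m-1,i}(u), replace each occurrence of i
-- by inc_{i-1,0}(v)
compose : Word → ℕ → ℕ → Word → Word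
compose u i m v =
  concatMap (λ a → if a ≡ᵇ i then inc (i ∸ 1) 0 v else [ a ]) (inc (m ∸ 1) i u)

count : ℕ → Word → ℕ
count a [] = 0
count a (b ∷ w) = if a ≡ᵇ b then suc (count a w) else count a w

-- F_k with an accumulator for the already-read prefix (stored reversed)
F-aux : ℕ → Word → Word → Word
F-aux k seen [] = []
F-aux k seen (a ∷ w) =
  if count a seen <ᵇ k then a ∷ F-aux k (a ∷ seen) w else F-aux k (a ∷ seen) w

-- F_k(u): keep only the first k occurrences of each letter
F : ℕ → Word → Word
F k u = F-aux k [] u

_≡[_]_ : Word → ℕ → Word → Set
u ≡[ k ] v = F k u ≡ F k v

{-# OPTIONS --safe #-}
-- Let s ≋ s′ say that every letter occurs equally often in s and s′ once counts are
-- truncated at k.  Since F_k decides whether to keep a letter from the truncated count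
-- of its occurrences so far, two words X and Y are interchangeable inside any word
-- (X ≃ Y) when, from ≋-equivalent prefixes, they give the same F_k-output and again
-- ≋-equivalent prefixes.  The key fact is that substituting words G a for the letters a
-- of u commutes with F_k: once a has occurred k times, each letter of G a has occurred
-- at least k times, so later copies of G a are erased entirely and change no truncated
-- count.  Hence concatMap G u ≃ concatMap G (F_k u), and u ∘ᵢ v, being such a
-- substitution, respects ≡ₖ in both arguments.
module Submission where

open import Defs
open import Data.Nat
open import Data.Nat.Properties
open import Data.Bool using (true; false; T; if_then_else_)
open import Data.List using ([]; _∷_; _++_; map; concatMap; [_]; _ʳ++_)
open import Data.List.Properties using (++-ʳ++; concatMap-map; concatMap-pure)
open import Data.Product using (_×_; _,_)
open import Data.Sum using (_⊎_; inj₁; inj₂)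
open import Data.Empty using (⊥-elim)
open import Relation.Nullary using (yes; no)
open import Function using (_∘′_)
open import Relation.Binary using (Setoid; IsEquivalence)
open import Relation.Binary.PropositionalEquality hiding ([_])

<ᵇ≡false⇒≥ : ∀ {m n} → (m <ᵇ n) ≡ false → n ≤ m
<ᵇ≡false⇒≥ e = ≮⇒≥ (λ m<n → subst T e (<⇒<ᵇ m<n))

≥⇒<ᵇ≡false : ∀ {m n} → n ≤ m → (m <ᵇ n) ≡ false
≥⇒<ᵇ≡false {m} {n} n≤m with m <ᵇ n in e
... | true  = ⊥-elim (<⇒≱ (<ᵇ⇒< m n (subst T (sym e) _)) n≤m)
... | false = refl

⊓-≡-cases : ∀ k {x y} → k ⊓ x ≡ k ⊓ y → x ≡ y ⊎ (k ≤ x × k ≤ y)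
⊓-≡-cases k {x} {y} e with x <? k | y <? k
... | yes x<k | yes y<k = inj₁ (trans (sym (m≥n⇒m⊓n≡n (<⇒≤ x<k)))
                                      (trans e (m≥n⇒m⊓n≡n (<⇒≤ y<k))))
... | yes x<k | no  y≮k = ⊥-elim (<-irrefl (trans (sym (m≥n⇒m⊓n≡n (<⇒≤ x<k)))
                                                   (trans e (m≤n⇒m⊓n≡m (≮⇒≥ y≮k)))) x<k)
... | no  x≮k | yes y<k = ⊥-elim (<-irrefl (trans (sym (m≥n⇒m⊓n≡n (<⇒≤ y<k)))
                                                   (trans (sym e) (m≤n⇒m⊓n≡m (≮⇒≥ x≮k)))) y<k)
... | no  x≮k | no  y≮k = inj₂ (≮⇒≥ x≮k , ≮⇒≥ y≮k)

⊓-cong-+ˡ : ∀ k c {x y} → k ⊓ x ≡ k ⊓ y → k ⊓ (c + x) ≡ k ⊓ (c + y)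
⊓-cong-+ˡ k c e with ⊓-≡-cases k e
... | inj₁ refl          = refl
... | inj₂ (k≤x , k≤y) =
  trans (m≤n⇒m⊓n≡m (≤-trans k≤x (m≤n+m _ c))) (sym (m≤n⇒m⊓n≡m (≤-trans k≤y (m≤n+m _ c))))

⊓-cong-<ᵇ : ∀ k {x y} → k ⊓ x ≡ k ⊓ y → (x <ᵇ k) ≡ (y <ᵇ k)
⊓-cong-<ᵇ k e with ⊓-≡-cases k e
... | inj₁ refl          = refl
... | inj₂ (k≤x , k≤y) = trans (≥⇒<ᵇ≡false k≤x) (sym (≥⇒<ᵇ≡false k≤y))

count-here : ∀ a s → count a (a ∷ s) ≡ suc (count a s)
count-here a s with a ≡ᵇ a in e
... | true  = refl
... | false = ⊥-elim (subst T e (≡⇒≡ᵇ a a refl))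

count-∷-≤ : ∀ c b s → count c s ≤ count c (b ∷ s)
count-∷-≤ c b s with c ≡ᵇ b
... | true  = n≤1+n _
... | false = ≤-refl

count-ʳ++ : ∀ c x s → count c (x ʳ++ s) ≡ count c x + count c s
count-ʳ++ c []      s = refl
count-ʳ++ c (b ∷ x) s = trans (count-ʳ++ c x (b ∷ s)) (move-head c b x s)
  where
  move-head : ∀ c b x s → count c x + count c (b ∷ s) ≡ count c (b ∷ x) + count c s
  move-head c b x s with c ≡ᵇ b
  ... | true  = +-suc _ _
  ... | false = refl

module Congruence (k : ℕ) where

  infix 4 _≋_ _≃_

  record _≋_ (s s′ : Word) : Set where
    constructor mk≋
    field truncated-count : ∀ c → k ⊓ count c s ≡ k ⊓ count c s′
  open _≋_

  ≋-refl : ∀ {s} → s ≋ s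
  ≋-refl = mk≋ λ _ → refl

  ≋-sym : ∀ {s s′} → s ≋ s′ → s′ ≋ s
  ≋-sym S = mk≋ λ c → sym (truncated-count S c)

  ≋-trans : ∀ {s s′ s″} → s ≋ s′ → s′ ≋ s″ → s ≋ s″
  ≋-trans S T = mk≋ λ c → trans (truncated-count S c) (truncated-count T c)

  ≋-ʳ++ : ∀ {s s′} x → s ≋ s′ → (x ʳ++ s) ≋ (x ʳ++ s′)
  ≋-ʳ++ {s} {s′} x S = mk≋ λ c → begin
    k ⊓ count c (x ʳ++ s)          ≡⟨ cong (k ⊓_) (count-ʳ++ c x s) ⟩
    k ⊓ (count c x + count c s)    ≡⟨ ⊓-cong-+ˡ k (count c x) (truncated-count S c) ⟩
    k ⊓ (count c x + count c s′)   ≡⟨ cong (k ⊓_) (count-ʳ++ c x s′) ⟨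
    k ⊓ count c (x ʳ++ s′)         ∎
    where open ≡-Reasoning

  Saturated : Word → Word → Set
  Saturated s y = ∀ c → 0 < count c y → k ≤ count c s

  ≋-ʳ++-saturated : ∀ {s s′ y} → Saturated s y → s ≋ s′ → (y ʳ++ s) ≋ s′
  ≋-ʳ++-saturated {s} {s′} {y} sat S = mk≋ λ c →
    trans (cong (k ⊓_) (count-ʳ++ c y s)) (absorb c)
    where
    absorb : ∀ c → k ⊓ (count c y + count c s) ≡ k ⊓ count c s′
    absorb c with count c y in e
    ... | zero  = truncated-count S c
    ... | suc _ = trans (m≤n⇒m⊓n≡m (≤-trans k≤s (m≤n+m _ _)))
                        (trans (sym (m≤n⇒m⊓n≡m k≤s)) (truncated-count S c))
      where k≤s = sat c (subst (0 <_) (sym e) z<s)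

  F-aux-cong : ∀ {s s′} → s ≋ s′ → ∀ w → F-aux k s w ≡ F-aux k s′ w
  F-aux-cong S []      = refl
  F-aux-cong {s} {s′} S (a ∷ w)
    rewrite ⊓-cong-<ᵇ k (truncated-count S a) with count a s′ <ᵇ k
  ... | true  = cong (a ∷_) (F-aux-cong (≋-ʳ++ [ a ] S) w)
  ... | false = F-aux-cong (≋-ʳ++ [ a ] S) w

  F-aux-++ : ∀ s x y → F-aux k s (x ++ y) ≡ F-aux k s x ++ F-aux k (x ʳ++ s) y
  F-aux-++ s []      y = refl
  F-aux-++ s (a ∷ x) y with count a s <ᵇ k
  ... | true  = cong (a ∷_) (F-aux-++ (a ∷ s) x y)
  ... | false = F-aux-++ (a ∷ s) x y

  F-aux-saturated : ∀ s y → Saturated s y → F-aux k s y ≡ []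
  F-aux-saturated s []      sat = refl
  F-aux-saturated s (b ∷ y) sat
    rewrite ≥⇒<ᵇ≡false (sat b (subst (0 <_) (sym (count-here b y)) z<s)) =
    F-aux-saturated (b ∷ s) y λ c p →
      ≤-trans (sat c (<-≤-trans p (count-∷-≤ c b y))) (count-∷-≤ c b s)

  record Agree (s x s′ x′ : Word) : Set where
    constructor _,_
    field
      output-≡ : F-aux k s x ≡ F-aux k s′ x′
      prefix-≋ : (x ʳ++ s) ≋ (x′ ʳ++ s′)
  open Agree

  Agree-sym : ∀ {s x s′ x′} → Agree s x s′ x′ → Agree s′ x′ s x
  Agree-sym (e , S) = sym e , ≋-sym S

  Agree-trans : ∀ {s x s′ x′ s″ x″} → Agree s x s′ x′ → Agree s′ x′ s″ x″ → Agree s x s″ x″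
  Agree-trans (e , S) (e′ , S′) = trans e e′ , ≋-trans S S′

  Agree-++ : ∀ {s x s′ x′ y y′} →
    Agree s x s′ x′ → Agree (x ʳ++ s) y (x′ ʳ++ s′) y′ → Agree s (x ++ y) s′ (x′ ++ y′)
  Agree-++ {s} {x} {s′} {x′} {y} {y′} (e , S) (e′ , S′) =
    trans (F-aux-++ s x y) (trans (cong₂ _++_ e e′) (sym (F-aux-++ s′ x′ y′))) ,
    subst₂ _≋_ (sym (++-ʳ++ x)) (sym (++-ʳ++ x′)) S′

  record _≃_ (x y : Word) : Set where
    constructor mk≃
    field agree : ∀ {s s′} → s ≋ s′ → Agree s x s′ y
  open _≃_

  ≃-refl : ∀ {x} → x ≃ x
  ≃-refl {x} = mk≃ λ S → F-aux-cong S x , ≋-ʳ++ x S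

  ≃-isEquivalence : IsEquivalence _≃_
  ≃-isEquivalence = record
    { refl  = ≃-refl
    ; sym   = λ p → mk≃ λ S → Agree-sym (agree p (≋-sym S))
    ; trans = λ p q → mk≃ λ S → Agree-trans (agree p S) (agree q ≋-refl)
    }

  ≃-setoid : Setoid _ _
  ≃-setoid = record { isEquivalence = ≃-isEquivalence }

  ≃⇒≡[k] : ∀ {x y} → x ≃ y → x ≡[ k ] y
  ≃⇒≡[k] p = output-≡ (agree p ≋-refl)

  ≃-++ : ∀ {x x′ y y′} → x ≃ x′ → y ≃ y′ → x ++ y ≃ x′ ++ y′
  ≃-++ p q = mk≃ λ S → Agree-++ (agree p S) (agree q (prefix-≋ (agree p S)))

  concatMap-cong-≃ : ∀ {G G′ : ℕ → Word} → (∀ a → G a ≃ G′ a) → ∀ u → concatMap G u ≃ concatMap G′ u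
  concatMap-cong-≃ G≃G′ []      = ≃-refl
  concatMap-cong-≃ G≃G′ (a ∷ u) = ≃-++ (G≃G′ a) (concatMap-cong-≃ G≃G′ u)

  module _ (G : ℕ → Word) where

    -- In Dominates t s, t is the part of u already read and s contains its image under
    -- concatMap G.
    Dominates : Word → Word → Set
    Dominates t s = ∀ a c → 0 < count c (G a) → count a t ≤ count c s

    Dominates-∷ : ∀ {t s} a → Dominates t s → Dominates (a ∷ t) (G a ʳ++ s)
    Dominates-∷ {t} {s} a D a′ c p rewrite count-ʳ++ c (G a) s with a′ ≡ᵇ a in e
    ... | true  = subst (λ b → suc (count a′ t) ≤ count c (G b) + count c s)
                        (≡ᵇ⇒≡ a′ a (subst T (sym e) _)) (+-mono-≤ p (D a′ c p))
    ... | false = ≤-trans (D a′ c p) (m≤n+m _ _)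

    concatMap-F-aux : ∀ {s₁ s₂ t} → s₁ ≋ s₂ → Dominates t s₁ →
      ∀ u → Agree s₁ (concatMap G u) s₂ (concatMap G (F-aux k t u))
    concatMap-F-aux S D []      = refl , S
    concatMap-F-aux {s₁} {s₂} {t} S D (a ∷ u) with count a t <ᵇ k in e
    ... | true  = Agree-++ (agree ≃-refl S)
                           (concatMap-F-aux (≋-ʳ++ (G a) S) (Dominates-∷ {t = t} a D) u)
    ... | false = Agree-++ {x′ = []} (F-aux-saturated s₁ (G a) sat , S′)
                                     (concatMap-F-aux S′ (Dominates-∷ {t = t} a D) u)
      where
      sat : Saturated s₁ (G a)
      sat c p = ≤-trans (<ᵇ≡false⇒≥ e) (D a c p)
      S′ : (G a ʳ++ s₁) ≋ s₂
      S′ = ≋-ʳ++-saturated {y = G a} sat S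

    concatMap-F-≃ : ∀ u → concatMap G u ≃ concatMap G (F k u)
    concatMap-F-≃ u = mk≃ λ S → concatMap-F-aux S (λ _ _ _ → z≤n) u

  open import Relation.Binary.Reasoning.Setoid ≃-setoid

  concatMap-≃ : ∀ {G G′ : ℕ → Word} u u′ → u ≡[ k ] u′ → (∀ a → G a ≃ G′ a) →
    concatMap G u ≃ concatMap G′ u′
  concatMap-≃ {G} {G′} u u′ u≡u′ G≃G′ = begin
    concatMap G u          ≈⟨ concatMap-F-≃ G u ⟩
    concatMap G (F k u)    ≡⟨ cong (concatMap G) u≡u′ ⟩
    concatMap G (F k u′)   ≈⟨ concatMap-F-≃ G u′ ⟨
    concatMap G u′         ≈⟨ concatMap-cong-≃ G≃G′ u′ ⟩
    concatMap G′ u′        ∎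

  map-≃ : ∀ (g : ℕ → ℕ) {v v′} → v ≡[ k ] v′ → map g v ≃ map g v′
  map-≃ g {v} {v′} v≡v′ = begin
    map g v                     ≡⟨ concatMap-pure (map g v) ⟨
    concatMap [_] (map g v)     ≡⟨ concatMap-map [_] g v ⟩
    concatMap ([_] ∘′ g) v      ≈⟨ concatMap-≃ v v′ v≡v′ (λ _ → ≃-refl) ⟩
    concatMap ([_] ∘′ g) v′     ≡⟨ concatMap-map [_] g v′ ⟨
    concatMap [_] (map g v′)    ≡⟨ concatMap-pure (map g v′) ⟩
    map g v′                    ∎

proposition3p2 : (k : ℕ) → 1 ≤ k →
    (n m : ℕ) → 1 ≤ n → 1 ≤ m →
    (u u′ : Word) → IsPacked n u → IsPacked n u′ → u ≡[ k ] u′ →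
    (v v′ : Word) → IsPacked m v → IsPacked m v′ → v ≡[ k ] v′ →
    (i : ℕ) → 1 ≤ i → i ≤ n →
    compose u i m v ≡[ k ] compose u′ i m v′
proposition3p2 k _ _ m _ _ u u′ _ _ u≡u′ v v′ _ _ v≡v′ i _ _ = ≃⇒≡[k] (begin
  compose u i m v                        ≡⟨ concatMap-map (substitute v) shift u ⟩
  concatMap (substitute v ∘′ shift) u    ≈⟨ concatMap-≃ u u′ u≡u′ (λ a → substitute-≃ (shift a)) ⟩
  concatMap (substitute v′ ∘′ shift) u′  ≡⟨ concatMap-map (substitute v′) shift u′ ⟨
  compose u′ i m v′                      ∎)
  where
  open Congruence k
  open import Relation.Binary.Reasoning.Setoid ≃-setoid

  shift : ℕ → ℕ
  shift a = if i <ᵇ a then a + (m ∸ 1) else a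

  substitute : Word → ℕ → Word
  substitute w b = if b ≡ᵇ i then inc (i ∸ 1) 0 w else [ b ]

  substitute-≃ : ∀ b → substitute v b ≃ substitute v′ b
  substitute-≃ b with b ≡ᵇ i
  ... | true  = map-≃ (λ a → if 0 <ᵇ a then a + (i ∸ 1) else a) v≡v′
  ... | false = ≃-refl
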